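{- Let $p:\mathcal E\to\mathcal I$ be a monoidal closed fibration and $q:\mathcal D\to\mathcal J$ a type refinement system, and let $(L\dashv R):p\dashv q$ be an adjunction of type refinement systems giving rise to a strong monad on $p$. Suppose $U\sqsubset C$ is a universal type in $q$ (with encodings $(e_S)_S$) which is reflected across the adjunction. Then for every e-type $T\sqsubset B$ of $p$ there is a vertical isomorphism $$\eta_B^{*}\big(R_1L_1T\big)\;\equiv\;\mathrm{shift}_{B,R_0C}^{*}\Big(\big(R_1U/T\big)\backslash R_1U\Big).$$
   Context: A type refinement system is a functor $p:\mathcal E\to\mathcal I$. Objects of $\mathcal I$ are i-types, morphisms of $\mathcal I$ are expressions; objects of $\mathcal E$ are e-types, morphisms of $\mathcal E$ are derivations. Composition is written diagrammatically ($f;g$ means $f$ then $g$). $S\sqsubset A$ ("$S$ refines $A$") means $p(S)=A$. For $f:A\to B$, $S\sqsubset A$, $T\sqsubset B$, a derivation of the typing judgment $S\Rightarrow_f T$ is a morphism $\alpha:S\to T$ in $\mathcal E$ with $p(\alpha)=f$. For $S,T\sqsubset A$, the subtyping judgment $S\le T$ is $S\Rightarrow_{\mathrm{id}_A}T$; $S\equiv T$ (vertical isomorphism) means there are derivations of $S\le T$ and $T\le S$ which compose (both ways) to identities. Pullback: for $f:A\to B$ and $T\sqsubset B$, a pullback of $T$ along $f$ is an e-type $f^*T\sqsubset A$ with a derivation $\ell$ of $f^*T\Rightarrow_f T$ and, for every e-type $S$ and expression $g:p(S)\to A$, a function $\beta\mapsto R(\beta)$ from derivations of $S\Rightarrow_{g;f}T$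 to derivations of $S\Rightarrow_g f^*T$, such that $R(\beta);\ell=\beta$ and $R(\eta;\ell)=\eta$ for all such $\beta$ and all derivations $\eta$ of $S\Rightarrow_g f^*T$ (equivalently, $\ell$ is a cartesian morphism over $f$). Pullbacks are unique up to $\equiv$. We say a derivation $\ell$ of $S\Rightarrow_f T$ exhibits $S$ as a pullback of $T$ along $f$ if it is the derivation $\ell$ of such a structure. A fibration is a type refinement system with all pullbacks. Monoidal closed structure on $\mathcal I$: monoidal product $\otimes$, unit $\mathbf 1$; for objects $A,C$ a left residual $A\backslash C$ with $\mathrm{ev}^l:A\otimes(A\backslash C)\to C$ and a natural bijection $\lambda$ from maps $A\otimes X\to C$ to maps $X\to A\backslash C$ with $(\mathrm{id}\otimes\lambda f);\mathrm{ev}^l=f$, $\lambda((\mathrm{id}\otimes g);\mathrm{ev}^l)=g$; and a right residual $C/B$ with $\mathrm{ev}^r:(C/B)\otimes B\to C$ and a bijection $\rho$ from maps $X\otimes B\to C$ to maps $X\to C/B$ with $(\rho f\otimes\mathrm{id});\mathrm{ev}^r=f$, $\rho((g\otimes \mathrm{id});\mathrm{ev}^r)=g$. Define $\mathrm{shift}_{B,C}:=\lambda(\mathrm{ev}^r):B\to (C/B)\backslash C$. A monoidal closed type refinement system is a strong monoidal functor $p$ (monoidal product on $\mathcal E$ also written $\otimes$, with $S\otimes T\sqsubset A\otimes B$ when $S\sqsubset A,T\sqsubset B$, and $\mathbf 1\sqsubset\mathbf 1$) over a monoidal closed $\mathcal I$ such that for all $S\sqsubset A$, $U\sqsubset C$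 there is an e-type $S\backslash U\sqsubset A\backslash C$ with a derivation $\mathrm{ev}^l_{S,U}$ of $S\otimes(S\backslash U)\Rightarrow_{\mathrm{ev}^l}U$ and an operation $\Lambda$ sending derivations $\beta$ of $S\otimes X\Rightarrow_f U$ to derivations of $X\Rightarrow_{\lambda f}S\backslash U$ with $(\mathrm{id}_S\otimes\Lambda\beta);\mathrm{ev}^l_{S,U}=\beta$ and $\Lambda((\mathrm{id}_S\otimes\eta);\mathrm{ev}^l_{S,U})=\eta$; and symmetrically, for $T\sqsubset B$, an e-type $U/T\sqsubset C/B$ with derivation $\mathrm{ev}^r_{U,T}$ of $(U/T)\otimes T\Rightarrow_{\mathrm{ev}^r}U$ and an operation $P$ from derivations $\beta$ of $X\otimes T\Rightarrow_f U$ to derivations of $X\Rightarrow_{\rho f}U/T$ with the analogous two equations. A monoidal closed fibration is such a system with all pullbacks, where $\otimes$ preserves pullbacks (the canonical derivation $f_1^*T_1\otimes f_2^*T_2\le (f_1\otimes f_2)^*(T_1\otimes T_2)$ is a vertical isomorphism). Adjunction of type refinement systems $(L\dashv R):p\dashv q$ for $p:\mathcal E\to\mathcal I$, $q:\mathcal D\to\mathcal J$ (objects of $\mathcal D$: d-types, of $\mathcal J$: j-types): functors $L_0:\mathcal I\to\mathcal J$, $L_1:\mathcal E\to\mathcal D$, $R_0:\mathcal J\to\mathcal I$, $R_1:\mathcal D\to\mathcal E$ with $qL_1=L_0p$, $pR_1=R_0q$, adjunctions $L_0\dashv R_0$ and $L_1\dashv R_1$ (units $\eta$, counits $\epsilon$)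 with $p(\eta_S)=\eta_{p(S)}$ and $q(\epsilon_T)=\epsilon_{q(T)}$. It gives rise to a strong monad on $p$ if the monad $R_0L_0$ carries a strength $\sigma_{A,B}:A\otimes R_0L_0B\to R_0L_0(A\otimes B)$ and the monad $R_1L_1$ carries a strength $\sigma_{S,T}:S\otimes R_1L_1T\to R_1L_1(S\otimes T)$, each compatible with unit and multiplication, with $p(\sigma_{S,T})=\sigma_{p S,p T}$. For d-types $S\sqsubset A$, $U\sqsubset C$ of $q$, an encoding of $S$ in $U$ is an expression $e_S:A\to C$ of $\mathcal J$ such that $S$ is a $q$-pullback of $U$ along $e_S$. A universal type in $q$ is a d-type $U$ with an encoding $e_S$ of every d-type $S$ in $U$. $U\sqsubset C$ is reflected across the adjunction if (1) $R$ preserves $q$-pullbacks (whenever a derivation $\alpha$ of $S\Rightarrow_f T$ exhibits $S$ as a $q$-pullback of $T$ along $f$, $R_1\alpha$ exhibits $R_1S$ as a $p$-pullback of $R_1T$ along $R_0f$), and (2) for each e-type $T\sqsubset B$ of $p$, the e-type $(R_1U/T)\backslash R_1U$ is the $p$-pullback of $R_1U$ along the expression $(R_0C/B)\backslash R_0C\cong \mathbf 1\otimes((R_0C/B)\backslash R_0C)\xrightarrow{\rho(\eta_B;R_0e_{L_1T})\otimes\mathrm{id}}(R_0C/B)\otimes((R_0C/B)\backslash R_0C)\xrightarrow{\mathrm{ev}^l}R_0C$, where $\eta_B;R_0e_{L_1T}:B\to R_0C$ is regarded as a map $\mathbf 1\otimes B\to R_0C$. -}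

module Defs where

-- Type refinement systems p : E → I are presented in "displayed" (fibred)
-- form: for every i-type A a type  Ob[ A ]  of e-types refining A
-- (S ⊏ A  ⇔  S : Ob[ A ]), and for every expression f : A → B a type
-- S ⇒[ f ] T  of derivations of the typing judgment S ⇒_f T.
-- This is exactly the data of the functor p (fibre over A, morphisms over f).
-- Composition is diagrammatic:  f ⨾ g  means f then g.

open import Level using (Level; _⊔_) renaming (suc to lsuc)
open import Relation.Binary.PropositionalEquality using (_≡_; refl; subst; sym)
open import Data.Product using (Σ; Σ-syntax; _×_; _,_; proj₁)

private variable a b : Level

PathOver : {A : Set a} (P : A → Set b) {x y : A} → x ≡ y → P x → P y → Set b
PathOver P e u v = subst P e u ≡ v

record Category (o h : Level) : Set (lsuc (o ⊔ h)) where
  infixr 9 _⨾_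
  field
    Obj   : Set o
    Hom   : Obj → Obj → Set h
    id    : ∀ {A} → Hom A A
    _⨾_   : ∀ {A B C} → Hom A B → Hom B C → Hom A C
    idˡ   : ∀ {A B} (f : Hom A B) → id ⨾ f ≡ f
    idʳ   : ∀ {A B} (f : Hom A B) → f ⨾ id ≡ f
    assoc : ∀ {A B C D} (f : Hom A B) (g : Hom B C) (k : Hom C D) →
            (f ⨾ g) ⨾ k ≡ f ⨾ (g ⨾ k)

record Functor {o h o' h'} (C : Category o h) (D : Category o' h')
       : Set (o ⊔ h ⊔ o' ⊔ h') where
  private
    module C = Category C
    module D = Category D
  field
    F₀    : C.Obj → D.Obj
    F₁    : ∀ {A B} → C.Hom A B → D.Hom (F₀ A) (F₀ B)
    F-id  : ∀ {A} → F₁ (C.id {A}) ≡ D.id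
    F-⨾   : ∀ {A B E} (f : C.Hom A B) (g : C.Hom B E) →
            F₁ (f C.⨾ g) ≡ F₁ f D.⨾ F₁ g

record Adjunction {o h o' h'} {C : Category o h} {D : Category o' h'}
       (L : Functor C D) (R : Functor D C) : Set (o ⊔ h ⊔ o' ⊔ h') where
  private
    module C = Category C
    module D = Category D
    module L = Functor L
    module R = Functor R
  field
    η      : ∀ A → C.Hom A (R.F₀ (L.F₀ A))
    ε      : ∀ X → D.Hom (L.F₀ (R.F₀ X)) X
    η-nat  : ∀ {A B} (f : C.Hom A B) → f C.⨾ η B ≡ η A C.⨾ R.F₁ (L.F₁ f)
    ε-nat  : ∀ {X Y} (g : D.Hom X Y) → L.F₁ (R.F₁ g) D.⨾ ε Y ≡ ε X D.⨾ g
    zig    : ∀ A → L.F₁ (η A) D.⨾ ε (L.F₀ A) ≡ D.id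
    zag    : ∀ X → η (R.F₀ X) C.⨾ R.F₁ (ε X) ≡ C.id

record Monoidal {o h} (C : Category o h) : Set (o ⊔ h) where
  open Category C
  infixr 10 _⊗₀_ _⊗₁_
  field
    𝟏     : Obj
    _⊗₀_  : Obj → Obj → Obj
    _⊗₁_  : ∀ {A A' B B'} → Hom A A' → Hom B B' → Hom (A ⊗₀ B) (A' ⊗₀ B')
    ⊗-id  : ∀ {A B} → id {A} ⊗₁ id {B} ≡ id
    ⊗-⨾   : ∀ {A A' A'' B B' B''} (f : Hom A A') (f' : Hom A' A'')
              (g : Hom B B') (g' : Hom B' B'') →
            (f ⨾ f') ⊗₁ (g ⨾ g') ≡ (f ⊗₁ g) ⨾ (f' ⊗₁ g')
    α⇒    : ∀ {A B E} → Hom ((A ⊗₀ B) ⊗₀ E) (A ⊗₀ (B ⊗₀ E))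
    α⇐    : ∀ {A B E} → Hom (A ⊗₀ (B ⊗₀ E)) ((A ⊗₀ B) ⊗₀ E)
    α-iso₁ : ∀ {A B E} → α⇒ {A} {B} {E} ⨾ α⇐ ≡ id
    α-iso₂ : ∀ {A B E} → α⇐ {A} {B} {E} ⨾ α⇒ ≡ id
    λ⇒    : ∀ {A} → Hom (𝟏 ⊗₀ A) A
    λ⇐    : ∀ {A} → Hom A (𝟏 ⊗₀ A)
    λ-iso₁ : ∀ {A} → λ⇒ {A} ⨾ λ⇐ ≡ id
    λ-iso₂ : ∀ {A} → λ⇐ {A} ⨾ λ⇒ ≡ id
    ρ⇒    : ∀ {A} → Hom (A ⊗₀ 𝟏) A
    ρ⇐    : ∀ {A} → Hom A (A ⊗₀ 𝟏)
    ρ-iso₁ : ∀ {A} → ρ⇒ {A} ⨾ ρ⇐ ≡ id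
    ρ-iso₂ : ∀ {A} → ρ⇐ {A} ⨾ ρ⇒ ≡ id
    α-nat : ∀ {A A' B B' E E'} (f : Hom A A') (g : Hom B B') (k : Hom E E') →
            ((f ⊗₁ g) ⊗₁ k) ⨾ α⇒ ≡ α⇒ ⨾ (f ⊗₁ (g ⊗₁ k))
    λ-nat : ∀ {A A'} (f : Hom A A') → (id ⊗₁ f) ⨾ λ⇒ ≡ λ⇒ ⨾ f
    ρ-nat : ∀ {A A'} (f : Hom A A') → (f ⊗₁ id) ⨾ ρ⇒ ≡ ρ⇒ ⨾ f
    pentagon : ∀ {A B E F} →
            (α⇒ {A} {B} {E} ⊗₁ id {F}) ⨾ α⇒ ⨾ (id ⊗₁ α⇒) ≡ α⇒ ⨾ α⇒
    triangle : ∀ {A B} → α⇒ {A} {𝟏} {B} ⨾ (id ⊗₁ λ⇒) ≡ ρ⇒ ⊗₁ id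

record Closed {o h} {C : Category o h} (M : Monoidal C) : Set (o ⊔ h) where
  open Category C
  open Monoidal M
  field
    _∖_    : Obj → Obj → Obj
    evˡ    : ∀ {A E} → Hom (A ⊗₀ (A ∖ E)) E
    curryˡ : ∀ {A X E} → Hom (A ⊗₀ X) E → Hom X (A ∖ E)
    curryˡ-β : ∀ {A X E} (f : Hom (A ⊗₀ X) E) → (id ⊗₁ curryˡ f) ⨾ evˡ ≡ f
    curryˡ-η : ∀ {A X E} (g : Hom X (A ∖ E)) → curryˡ ((id ⊗₁ g) ⨾ evˡ) ≡ g
    _∕_    : Obj → Obj → Obj
    evʳ    : ∀ {E B} → Hom ((E ∕ B) ⊗₀ B) E
    curryʳ : ∀ {X B E} → Hom (X ⊗₀ B) E → Hom X (E ∕ B)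
    curryʳ-β : ∀ {X B E} (f : Hom (X ⊗₀ B) E) → (curryʳ f ⊗₁ id) ⨾ evʳ ≡ f
    curryʳ-η : ∀ {X B E} (g : Hom X (E ∕ B)) → curryʳ ((g ⊗₁ id) ⨾ evʳ) ≡ g

  shift : ∀ B E → Hom B ((E ∕ B) ∖ E)
  shift B E = curryˡ (evʳ {E} {B})

record TRS {o h} (I : Category o h) (o' h' : Level)
       : Set (o ⊔ h ⊔ lsuc (o' ⊔ h')) where
  open Category I
  infixr 9 _⨾'_
  field
    Ob[_]  : Obj → Set o'
    _⇒[_]_ : ∀ {A B} → Ob[ A ] → Hom A B → Ob[ B ] → Set h'
    id'    : ∀ {A} {S : Ob[ A ]} → S ⇒[ id ] S
    _⨾'_   : ∀ {A B E} {f : Hom A B} {g : Hom B E} {S T U} →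
             S ⇒[ f ] T → T ⇒[ g ] U → S ⇒[ f ⨾ g ] U
    idˡ'   : ∀ {A B} {f : Hom A B} {S T} (α : S ⇒[ f ] T) →
             PathOver (λ k → S ⇒[ k ] T) (idˡ f) (id' ⨾' α) α
    idʳ'   : ∀ {A B} {f : Hom A B} {S T} (α : S ⇒[ f ] T) →
             PathOver (λ k → S ⇒[ k ] T) (idʳ f) (α ⨾' id') α
    assoc' : ∀ {A B E F} {f : Hom A B} {g : Hom B E} {k : Hom E F} {S T U V}
             (α : S ⇒[ f ] T) (β : T ⇒[ g ] U) (γ : U ⇒[ k ] V) →
             PathOver (λ m → S ⇒[ m ] V) (assoc f g k) ((α ⨾' β) ⨾' γ) (α ⨾' (β ⨾' γ))

  _≤_ : ∀ {A} → Ob[ A ] → Ob[ A ] → Set h'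
  S ≤ T = S ⇒[ id ] T

  IsVerticalIso : ∀ {A} {S T : Ob[ A ]} → S ≤ T → Set h'
  IsVerticalIso {S = S} {T} φ =
    Σ[ ψ ∈ T ≤ S ]
      (PathOver (λ k → S ⇒[ k ] S) (idˡ id) (φ ⨾' ψ) id' ×
       PathOver (λ k → T ⇒[ k ] T) (idˡ id) (ψ ⨾' φ) id')

  VerticalIso : ∀ {A} → Ob[ A ] → Ob[ A ] → Set h'
  VerticalIso S T = Σ[ φ ∈ S ≤ T ] IsVerticalIso φ

  -- ℓ : S ⇒_f T is cartesian, i.e. exhibits S as a pullback of T along f
  record Exhibits {A B} {f : Hom A B} {S : Ob[ A ]} {T : Ob[ B ]}
                  (ℓ : S ⇒[ f ] T) : Set (o ⊔ h ⊔ o' ⊔ h') where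
    field
      R     : ∀ {X} {Y : Ob[ X ]} {g : Hom X A} → Y ⇒[ g ⨾ f ] T → Y ⇒[ g ] S
      R-β   : ∀ {X} {Y : Ob[ X ]} {g : Hom X A} (β : Y ⇒[ g ⨾ f ] T) → R β ⨾' ℓ ≡ β
      R-η   : ∀ {X} {Y : Ob[ X ]} {g : Hom X A} (ζ : Y ⇒[ g ] S) → R (ζ ⨾' ℓ) ≡ ζ

  IsPullbackOf : ∀ {A B} → Ob[ A ] → Hom A B → Ob[ B ] → Set (o ⊔ h ⊔ o' ⊔ h')
  IsPullbackOf S f T = Σ[ ℓ ∈ S ⇒[ f ] T ] Exhibits ℓ

  record Pullback {A B} (f : Hom A B) (T : Ob[ B ]) : Set (o ⊔ h ⊔ o' ⊔ h') where
    field
      obj   : Ob[ A ]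
      ℓ     : obj ⇒[ f ] T
      cart  : Exhibits ℓ

  Fibration : Set (o ⊔ h ⊔ o' ⊔ h')
  Fibration = ∀ {A B} (f : Hom A B) (T : Ob[ B ]) → Pullback f T

record TRSFunctor {oi hi oj hj oe he od hd}
       {I : Category oi hi} {J : Category oj hj}
       (E : TRS I oe he) (D : TRS J od hd) (F : Functor I J)
       : Set (oi ⊔ hi ⊔ oe ⊔ he ⊔ od ⊔ hd) where
  private
    module I = Category I
    module J = Category J
    module E = TRS E
    module D = TRS D
  open Functor F
  field
    G₀   : ∀ {A} → E.Ob[ A ] → D.Ob[ F₀ A ]
    G₁   : ∀ {A B} {f : I.Hom A B} {S T} → S E.⇒[ f ] T → G₀ S D.⇒[ F₁ f ] G₀ T
    G-id : ∀ {A} {S : E.Ob[ A ]} →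
           PathOver (λ k → G₀ S D.⇒[ k ] G₀ S) F-id (G₁ (E.id' {S = S})) D.id'
    G-⨾  : ∀ {A B C} {f : I.Hom A B} {g : I.Hom B C} {S T U}
           (α : S E.⇒[ f ] T) (β : T E.⇒[ g ] U) →
           PathOver (λ k → G₀ S D.⇒[ k ] G₀ U) (F-⨾ f g) (G₁ (α E.⨾' β)) (G₁ α D.⨾' G₁ β)

record TRSAdjunction {oi hi oj hj oe he od hd}
       {I : Category oi hi} {J : Category oj hj}
       {E : TRS I oe he} {D : TRS J od hd}
       {L₀ : Functor I J} {R₀ : Functor J I} (adj₀ : Adjunction L₀ R₀)
       (L₁ : TRSFunctor E D L₀) (R₁ : TRSFunctor D E R₀)
       : Set (oi ⊔ hi ⊔ oj ⊔ hj ⊔ oe ⊔ he ⊔ od ⊔ hd) where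
  private
    module I = Category I
    module J = Category J
    module E = TRS E
    module D = TRS D
    module L₀ = Functor L₀
    module R₀ = Functor R₀
    module L₁ = TRSFunctor L₁
    module R₁ = TRSFunctor R₁
  open Adjunction adj₀
  field
    η'     : ∀ {A} (S : E.Ob[ A ]) → S E.⇒[ η A ] R₁.G₀ (L₁.G₀ S)
    ε'     : ∀ {X} (T : D.Ob[ X ]) → L₁.G₀ (R₁.G₀ T) D.⇒[ ε X ] T
    η'-nat : ∀ {A B} {f : I.Hom A B} {S T} (α : S E.⇒[ f ] T) →
             PathOver (λ k → S E.⇒[ k ] R₁.G₀ (L₁.G₀ T)) (η-nat f)
                      (α E.⨾' η' T) (η' S E.⨾' R₁.G₁ (L₁.G₁ α))
    ε'-nat : ∀ {X Y} {g : J.Hom X Y} {S T} (β : S D.⇒[ g ] T) →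
             PathOver (λ k → L₁.G₀ (R₁.G₀ S) D.⇒[ k ] T) (ε-nat g)
                      (L₁.G₁ (R₁.G₁ β) D.⨾' ε' T) (ε' S D.⨾' β)
    zig'   : ∀ {A} (S : E.Ob[ A ]) →
             PathOver (λ k → L₁.G₀ S D.⇒[ k ] L₁.G₀ S) (zig A)
                      (L₁.G₁ (η' S) D.⨾' ε' (L₁.G₀ S)) D.id'
    zag'   : ∀ {X} (T : D.Ob[ X ]) →
             PathOver (λ k → R₁.G₀ T E.⇒[ k ] R₁.G₀ T) (zag X)
                      (η' (R₁.G₀ T) E.⨾' R₁.G₁ (ε' T)) E.id'

record MonoidalTRS {o h o' h'} {I : Category o h} (M : Monoidal I) (E : TRS I o' h')
       : Set (o ⊔ h ⊔ o' ⊔ h') where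
  open Category I
  open Monoidal M
  open TRS E
  infixr 10 _⊗₀'_ _⊗₁'_
  field
    𝟏'     : Ob[ 𝟏 ]
    _⊗₀'_  : ∀ {A B} → Ob[ A ] → Ob[ B ] → Ob[ A ⊗₀ B ]
    _⊗₁'_  : ∀ {A A' B B'} {f : Hom A A'} {g : Hom B B'} {S S' T T'} →
             S ⇒[ f ] S' → T ⇒[ g ] T' → (S ⊗₀' T) ⇒[ f ⊗₁ g ] (S' ⊗₀' T')
    ⊗-id'  : ∀ {A B} {S : Ob[ A ]} {T : Ob[ B ]} →
             PathOver (λ k → (S ⊗₀' T) ⇒[ k ] (S ⊗₀' T)) ⊗-id (id' {S = S} ⊗₁' id' {S = T}) id'
    ⊗-⨾'   : ∀ {A A' A'' B B' B''} {f : Hom A A'} {f' : Hom A' A''}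
               {g : Hom B B'} {g' : Hom B' B''} {S S' S'' T T' T''}
               (α : S ⇒[ f ] S') (α' : S' ⇒[ f' ] S'')
               (β : T ⇒[ g ] T') (β' : T' ⇒[ g' ] T'') →
             PathOver (λ k → (S ⊗₀' T) ⇒[ k ] (S'' ⊗₀' T'')) (⊗-⨾ f f' g g')
               ((α ⨾' α') ⊗₁' (β ⨾' β')) ((α ⊗₁' β) ⨾' (α' ⊗₁' β'))
    α⇒'    : ∀ {A B C} {S : Ob[ A ]} {T : Ob[ B ]} {U : Ob[ C ]} →
             ((S ⊗₀' T) ⊗₀' U) ⇒[ α⇒ ] (S ⊗₀' (T ⊗₀' U))
    α⇐'    : ∀ {A B C} {S : Ob[ A ]} {T : Ob[ B ]} {U : Ob[ C ]} →
             (S ⊗₀' (T ⊗₀' U)) ⇒[ α⇐ ] ((S ⊗₀' T) ⊗₀' U)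
    α-iso₁' : ∀ {A B C} {S : Ob[ A ]} {T : Ob[ B ]} {U : Ob[ C ]} →
             PathOver (λ k → ((S ⊗₀' T) ⊗₀' U) ⇒[ k ] ((S ⊗₀' T) ⊗₀' U)) α-iso₁
               (α⇒' ⨾' α⇐') id'
    α-iso₂' : ∀ {A B C} {S : Ob[ A ]} {T : Ob[ B ]} {U : Ob[ C ]} →
             PathOver (λ k → (S ⊗₀' (T ⊗₀' U)) ⇒[ k ] (S ⊗₀' (T ⊗₀' U))) α-iso₂
               (α⇐' ⨾' α⇒') id'
    λ⇒'    : ∀ {A} {S : Ob[ A ]} → (𝟏' ⊗₀' S) ⇒[ λ⇒ ] S
    λ⇐'    : ∀ {A} {S : Ob[ A ]} → S ⇒[ λ⇐ ] (𝟏' ⊗₀' S)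
    λ-iso₁' : ∀ {A} {S : Ob[ A ]} →
             PathOver (λ k → (𝟏' ⊗₀' S) ⇒[ k ] (𝟏' ⊗₀' S)) λ-iso₁ (λ⇒' ⨾' λ⇐') id'
    λ-iso₂' : ∀ {A} {S : Ob[ A ]} →
             PathOver (λ k → S ⇒[ k ] S) λ-iso₂ (λ⇐' ⨾' λ⇒') id'
    ρ⇒'    : ∀ {A} {S : Ob[ A ]} → (S ⊗₀' 𝟏') ⇒[ ρ⇒ ] S
    ρ⇐'    : ∀ {A} {S : Ob[ A ]} → S ⇒[ ρ⇐ ] (S ⊗₀' 𝟏')
    ρ-iso₁' : ∀ {A} {S : Ob[ A ]} →
             PathOver (λ k → (S ⊗₀' 𝟏') ⇒[ k ] (S ⊗₀' 𝟏')) ρ-iso₁ (ρ⇒' ⨾' ρ⇐') id'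
    ρ-iso₂' : ∀ {A} {S : Ob[ A ]} →
             PathOver (λ k → S ⇒[ k ] S) ρ-iso₂ (ρ⇐' ⨾' ρ⇒') id'
    α-nat' : ∀ {A A' B B' C C'} {f : Hom A A'} {g : Hom B B'} {k : Hom C C'}
               {S S' T T' U U'}
               (α : S ⇒[ f ] S') (β : T ⇒[ g ] T') (γ : U ⇒[ k ] U') →
             PathOver (λ m → ((S ⊗₀' T) ⊗₀' U) ⇒[ m ] (S' ⊗₀' (T' ⊗₀' U'))) (α-nat f g k)
               (((α ⊗₁' β) ⊗₁' γ) ⨾' α⇒') (α⇒' ⨾' (α ⊗₁' (β ⊗₁' γ)))
    λ-nat' : ∀ {A A'} {f : Hom A A'} {S S'} (α : S ⇒[ f ] S') →
             PathOver (λ m → (𝟏' ⊗₀' S) ⇒[ m ] S') (λ-nat f)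
               ((id' ⊗₁' α) ⨾' λ⇒') (λ⇒' ⨾' α)
    ρ-nat' : ∀ {A A'} {f : Hom A A'} {S S'} (α : S ⇒[ f ] S') →
             PathOver (λ m → (S ⊗₀' 𝟏') ⇒[ m ] S') (ρ-nat f)
               ((α ⊗₁' id') ⨾' ρ⇒') (ρ⇒' ⨾' α)
    pentagon' : ∀ {A B C D} {S : Ob[ A ]} {T : Ob[ B ]} {U : Ob[ C ]} {V : Ob[ D ]} →
             PathOver (λ m → (((S ⊗₀' T) ⊗₀' U) ⊗₀' V) ⇒[ m ] (S ⊗₀' (T ⊗₀' (U ⊗₀' V))))
               pentagon
               ((α⇒' ⊗₁' id') ⨾' α⇒' ⨾' (id' ⊗₁' α⇒')) (α⇒' ⨾' α⇒')
    triangle' : ∀ {A B} {S : Ob[ A ]} {T : Ob[ B ]} →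
             PathOver (λ m → ((S ⊗₀' 𝟏') ⊗₀' T) ⇒[ m ] (S ⊗₀' T)) triangle
               (α⇒' ⨾' (id' ⊗₁' λ⇒')) (ρ⇒' ⊗₁' id')

record ClosedTRS {o h o' h'} {I : Category o h} {M : Monoidal I} (CI : Closed M)
       {E : TRS I o' h'} (ME : MonoidalTRS M E) : Set (o ⊔ h ⊔ o' ⊔ h') where
  open Category I
  open Monoidal M
  open Closed CI
  open TRS E
  open MonoidalTRS ME
  field
    _∖'_   : ∀ {A C} → Ob[ A ] → Ob[ C ] → Ob[ A ∖ C ]
    evˡ'   : ∀ {A C} {S : Ob[ A ]} {U : Ob[ C ]} → (S ⊗₀' (S ∖' U)) ⇒[ evˡ ] U
    Λ      : ∀ {A C X} {S : Ob[ A ]} {U : Ob[ C ]} {Y : Ob[ X ]} {f : Hom (A ⊗₀ X) C} →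
             (S ⊗₀' Y) ⇒[ f ] U → Y ⇒[ curryˡ f ] (S ∖' U)
    Λ-β    : ∀ {A C X} {S : Ob[ A ]} {U : Ob[ C ]} {Y : Ob[ X ]} {f : Hom (A ⊗₀ X) C}
             (β : (S ⊗₀' Y) ⇒[ f ] U) →
             PathOver (λ k → (S ⊗₀' Y) ⇒[ k ] U) (curryˡ-β f) ((id' ⊗₁' Λ β) ⨾' evˡ') β
    Λ-η    : ∀ {A C X} {S : Ob[ A ]} {U : Ob[ C ]} {Y : Ob[ X ]} {g : Hom X (A ∖ C)}
             (ζ : Y ⇒[ g ] (S ∖' U)) →
             PathOver (λ k → Y ⇒[ k ] (S ∖' U)) (curryˡ-η g) (Λ ((id' ⊗₁' ζ) ⨾' evˡ')) ζ
    _∕'_   : ∀ {C B} → Ob[ C ] → Ob[ B ] → Ob[ C ∕ B ]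
    evʳ'   : ∀ {C B} {U : Ob[ C ]} {T : Ob[ B ]} → ((U ∕' T) ⊗₀' T) ⇒[ evʳ ] U
    P      : ∀ {C B X} {U : Ob[ C ]} {T : Ob[ B ]} {Y : Ob[ X ]} {f : Hom (X ⊗₀ B) C} →
             (Y ⊗₀' T) ⇒[ f ] U → Y ⇒[ curryʳ f ] (U ∕' T)
    P-β    : ∀ {C B X} {U : Ob[ C ]} {T : Ob[ B ]} {Y : Ob[ X ]} {f : Hom (X ⊗₀ B) C}
             (β : (Y ⊗₀' T) ⇒[ f ] U) →
             PathOver (λ k → (Y ⊗₀' T) ⇒[ k ] U) (curryʳ-β f) ((P β ⊗₁' id') ⨾' evʳ') β
    P-η    : ∀ {C B X} {U : Ob[ C ]} {T : Ob[ B ]} {Y : Ob[ X ]} {g : Hom X (C ∕ B)}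
             (ζ : Y ⇒[ g ] (U ∕' T)) →
             PathOver (λ k → Y ⇒[ k ] (U ∕' T)) (curryʳ-η g) (P ((ζ ⊗₁' id') ⨾' evʳ')) ζ

-- ⊗ preserves (the chosen) pullbacks: the canonical derivation
-- f₁*T₁ ⊗ f₂*T₂ ≤ (f₁ ⊗ f₂)*(T₁ ⊗ T₂), i.e. R(ℓ₁ ⊗ ℓ₂), is a vertical isomorphism
TensorPreservesPullbacks : ∀ {o h o' h'} {I : Category o h} {M : Monoidal I}
  {E : TRS I o' h'} → MonoidalTRS M E → TRS.Fibration E → Set (o ⊔ h ⊔ o' ⊔ h')
TensorPreservesPullbacks {I = I} {M} {E} ME fib =
  ∀ {A₁ B₁ A₂ B₂} (f₁ : Hom A₁ B₁) (f₂ : Hom A₂ B₂) (T₁ : Ob[ B₁ ]) (T₂ : Ob[ B₂ ]) →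
    IsVerticalIso
      (Exhibits.R (Pullback.cart (fib (f₁ ⊗₁ f₂) (T₁ ⊗₀' T₂)))
        (subst (λ k → (Pullback.obj (fib f₁ T₁) ⊗₀' Pullback.obj (fib f₂ T₂))
                         ⇒[ k ] (T₁ ⊗₀' T₂))
               (sym (idˡ (f₁ ⊗₁ f₂)))
               (Pullback.ℓ (fib f₁ T₁) ⊗₁' Pullback.ℓ (fib f₂ T₂))))
  where
  open Category I
  open Monoidal M
  open TRS E
  open MonoidalTRS ME

record Strength {oi hi oj hj} {I : Category oi hi} {J : Category oj hj}
       (M : Monoidal I) {L₀ : Functor I J} {R₀ : Functor J I}
       (adj₀ : Adjunction L₀ R₀) : Set (oi ⊔ hi ⊔ oj ⊔ hj) where
  open Category I
  open Monoidal M
  open Adjunction adj₀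
  private
    module L₀ = Functor L₀
    module R₀ = Functor R₀
  T₀ : Obj → Obj
  T₀ A = R₀.F₀ (L₀.F₀ A)
  T₁ : ∀ {A B} → Hom A B → Hom (T₀ A) (T₀ B)
  T₁ f = R₀.F₁ (L₀.F₁ f)
  μ : ∀ A → Hom (T₀ (T₀ A)) (T₀ A)
  μ A = R₀.F₁ (ε (L₀.F₀ A))
  field
    σ      : ∀ A B → Hom (A ⊗₀ T₀ B) (T₀ (A ⊗₀ B))
    σ-nat  : ∀ {A A' B B'} (f : Hom A A') (g : Hom B B') →
             (f ⊗₁ T₁ g) ⨾ σ A' B' ≡ σ A B ⨾ T₁ (f ⊗₁ g)
    σ-η    : ∀ A B → (id ⊗₁ η B) ⨾ σ A B ≡ η (A ⊗₀ B)
    σ-μ    : ∀ A B → (id ⊗₁ μ B) ⨾ σ A B ≡ σ A (T₀ B) ⨾ T₁ (σ A B) ⨾ μ (A ⊗₀ B)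

record StrengthTRS {oi hi oj hj oe he od hd}
       {I : Category oi hi} {J : Category oj hj}
       {E : TRS I oe he} {D : TRS J od hd} {M : Monoidal I} (ME : MonoidalTRS M E)
       {L₀ : Functor I J} {R₀ : Functor J I} {adj₀ : Adjunction L₀ R₀}
       {L₁ : TRSFunctor E D L₀} {R₁ : TRSFunctor D E R₀}
       (adj₁ : TRSAdjunction adj₀ L₁ R₁) (st₀ : Strength M adj₀)
       : Set (oi ⊔ hi ⊔ oj ⊔ hj ⊔ oe ⊔ he ⊔ od ⊔ hd) where
  open Category I
  open Monoidal M
  open Adjunction adj₀
  open Strength st₀
  open TRS E
  open MonoidalTRS ME
  open TRSAdjunction adj₁
  private
    module L₁ = TRSFunctor L₁
    module R₁ = TRSFunctor R₁
  T₀' : ∀ {A} → Ob[ A ] → Ob[ T₀ A ]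
  T₀' S = R₁.G₀ (L₁.G₀ S)
  T₁' : ∀ {A B} {f : Hom A B} {S T} → S ⇒[ f ] T → T₀' S ⇒[ T₁ f ] T₀' T
  T₁' α = R₁.G₁ (L₁.G₁ α)
  μ' : ∀ {A} (S : Ob[ A ]) → T₀' (T₀' S) ⇒[ μ A ] T₀' S
  μ' S = R₁.G₁ (ε' (L₁.G₀ S))
  field
    σ'     : ∀ {A B} (S : Ob[ A ]) (T : Ob[ B ]) → (S ⊗₀' T₀' T) ⇒[ σ A B ] T₀' (S ⊗₀' T)
    σ'-nat : ∀ {A A' B B'} {f : Hom A A'} {g : Hom B B'} {S S' T T'}
             (α : S ⇒[ f ] S') (β : T ⇒[ g ] T') →
             PathOver (λ k → (S ⊗₀' T₀' T) ⇒[ k ] T₀' (S' ⊗₀' T')) (σ-nat f g)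
               ((α ⊗₁' T₁' β) ⨾' σ' S' T') (σ' S T ⨾' T₁' (α ⊗₁' β))
    σ'-η   : ∀ {A B} (S : Ob[ A ]) (T : Ob[ B ]) →
             PathOver (λ k → (S ⊗₀' T) ⇒[ k ] T₀' (S ⊗₀' T)) (σ-η A B)
               ((id' ⊗₁' η' T) ⨾' σ' S T) (η' (S ⊗₀' T))
    σ'-μ   : ∀ {A B} (S : Ob[ A ]) (T : Ob[ B ]) →
             PathOver (λ k → (S ⊗₀' T₀' (T₀' T)) ⇒[ k ] T₀' (S ⊗₀' T)) (σ-μ A B)
               ((id' ⊗₁' μ' T) ⨾' σ' S T) (σ' S (T₀' T) ⨾' T₁' (σ' S T) ⨾' μ' (S ⊗₀' T))

Encoding : ∀ {o h o' h'} {J : Category o h} (D : TRS J o' h')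
  {A C : Category.Obj J} → TRS.Ob[_] D A → TRS.Ob[_] D C → Set (o ⊔ h ⊔ o' ⊔ h')
Encoding {J = J} D {A} {C} S U = Σ[ e ∈ Category.Hom J A C ] TRS.IsPullbackOf D S e U

Universal : ∀ {o h o' h'} {J : Category o h} (D : TRS J o' h')
  {C : Category.Obj J} → TRS.Ob[_] D C → Set (o ⊔ h ⊔ o' ⊔ h')
Universal {J = J} D U = ∀ {A} (S : TRS.Ob[_] D A) → Encoding D S U

record Reflected {oi hi oj hj oe he od hd}
       {I : Category oi hi} {J : Category oj hj}
       {E : TRS I oe he} {D : TRS J od hd}
       {M : Monoidal I} (CI : Closed M) (ME : MonoidalTRS M E) (CE : ClosedTRS CI ME)
       {L₀ : Functor I J} {R₀ : Functor J I} (adj₀ : Adjunction L₀ R₀)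
       (L₁ : TRSFunctor E D L₀) (R₁ : TRSFunctor D E R₀)
       {C : Category.Obj J} (U : TRS.Ob[_] D C) (enc : Universal D U)
       : Set (oi ⊔ hi ⊔ oj ⊔ hj ⊔ oe ⊔ he ⊔ od ⊔ hd) where
  open Category I
  open Monoidal M
  open Closed CI
  open TRS E
  open MonoidalTRS ME
  open ClosedTRS CE
  open Adjunction adj₀
  private
    module J = Category J
    module D = TRS D
    module L₀ = Functor L₀
    module R₀ = Functor R₀
    module L₁ = TRSFunctor L₁
    module R₁ = TRSFunctor R₁
  reflExpr : ∀ {B} (T : Ob[ B ]) → Hom ((R₀.F₀ C ∕ B) ∖ R₀.F₀ C) (R₀.F₀ C)
  reflExpr {B} T =
    λ⇐ ⨾ (curryʳ (λ⇒ ⨾ η B ⨾ R₀.F₁ (proj₁ (enc (L₁.G₀ T)))) ⊗₁ id) ⨾ evˡ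
  field
    preservesPullbacks : ∀ {X Y} {f : J.Hom X Y} {S T} (α : S D.⇒[ f ] T) →
      D.Exhibits α → Exhibits (R₁.G₁ α)
    reflectsShift : ∀ {B} (T : Ob[ B ]) →
      IsPullbackOf ((R₁.G₀ U ∕' T) ∖' R₁.G₀ U) (reflExpr T) (R₁.G₀ U)

module Submission where

-- Write e : L₀B → C for the encoding of L₁T in U.  Both sides
-- of the vertical isomorphism are p-pullbacks of the SAME e-type R₁U along
-- the SAME expression B → R₀C:
--   * η_B*(R₁L₁T) → R₁L₁T → R₁U  exhibits a pullback along  η_B ; R₀e,
--     by pasting the chosen pullback with R₁ applied to the encoding of
--     L₁T (R preserves q-pullbacks);
--   * shift*((R₁U∕T)∖R₁U) → (R₁U∕T)∖R₁U → R₁U  exhibits a pullback along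
--     shift ; reflExpr T, by pasting with the reflection hypothesis;
--   * in any monoidal closed category every g : B → X factors as
--     shift_{B,X} ; (λ⇐ ; (ρ(λ⇒ ; g) ⊗ id) ; evˡ), so the two expressions
--     agree for g = η_B ; R₀e.
-- Since pullbacks are unique up to vertical isomorphism, the theorem
-- follows.

open import Level using (Level; _⊔_)
open import Defs
open import Relation.Binary.PropositionalEquality
open import Data.Product using (Σ-syntax; _,_; proj₁; proj₂)

module Cartesian {o h o' h'} {I : Category o h} (E : TRS I o' h') where
  open Category I
  open TRS E

  -- Two derivations S ⇒ T are equal as morphisms of the total category:
  -- their expressions agree and, transported along that, so do they.
  infix 4 _≅_
  _≅_ : ∀ {A B} {S : Ob[ A ]} {T : Ob[ B ]} {f g : Hom A B} →
        S ⇒[ f ] T → S ⇒[ g ] T → Set (h ⊔ h')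
  _≅_ {S = S} {T} {f} {g} α β = Σ[ e ∈ f ≡ g ] PathOver (λ k → S ⇒[ k ] T) e α β

  module _ {A B} {S : Ob[ A ]} {T : Ob[ B ]} where
    ≅-sym : ∀ {f g} {α : S ⇒[ f ] T} {β : S ⇒[ g ] T} → α ≅ β → β ≅ α
    ≅-sym (refl , refl) = refl , refl

    ≅-trans : ∀ {f g k} {α : S ⇒[ f ] T} {β : S ⇒[ g ] T} {γ : S ⇒[ k ] T} →
              α ≅ β → β ≅ γ → α ≅ γ
    ≅-trans (refl , refl) q = q

    ≡→≅ : ∀ {f} {α β : S ⇒[ f ] T} → α ≡ β → α ≅ β
    ≡→≅ p = refl , p

    -- over a fixed expression ≅ is plain equality (uses uniqueness of
    -- identity proofs for expressions)
    ≅→PathOver : ∀ {f g} {α : S ⇒[ f ] T} {β : S ⇒[ g ] T} (e : f ≡ g) →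
                 α ≅ β → PathOver (λ k → S ⇒[ k ] T) e α β
    ≅→PathOver refl (refl , p) = p

    ≅→≡ : ∀ {f} {α β : S ⇒[ f ] T} → α ≅ β → α ≡ β
    ≅→≡ = ≅→PathOver refl

    cast : ∀ {f g} → f ≡ g → S ⇒[ f ] T → S ⇒[ g ] T
    cast e α = subst (λ k → S ⇒[ k ] T) e α

    cast-≅ : ∀ {f g} (e : f ≡ g) (α : S ⇒[ f ] T) → cast e α ≅ α
    cast-≅ refl α = refl , refl

  module ≅-Reasoning {A B} {S : Ob[ A ]} {T : Ob[ B ]} where
    infix  1 begin_
    infixr 2 _≅⟨_⟩_
    infix  3 _∎

    begin_ : ∀ {f g} {α : S ⇒[ f ] T} {β : S ⇒[ g ] T} → α ≅ β → α ≅ β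
    begin p = p

    _≅⟨_⟩_ : ∀ {f g k} (α : S ⇒[ f ] T) {β : S ⇒[ g ] T} {γ : S ⇒[ k ] T} →
             α ≅ β → β ≅ γ → α ≅ γ
    _ ≅⟨ p ⟩ q = ≅-trans p q

    _∎ : ∀ {f} (α : S ⇒[ f ] T) → α ≅ α
    _ ∎ = refl , refl

  ⨾-congˡ : ∀ {A B C} {S : Ob[ A ]} {T : Ob[ B ]} {V : Ob[ C ]} {f f' g}
    {α : S ⇒[ f ] T} {α' : S ⇒[ f' ] T} (β : T ⇒[ g ] V) →
    α ≅ α' → (α ⨾' β) ≅ (α' ⨾' β)
  ⨾-congˡ β (refl , refl) = refl , refl

  ⨾-congʳ : ∀ {A B C} {S : Ob[ A ]} {T : Ob[ B ]} {V : Ob[ C ]} {f g g'}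
    (α : S ⇒[ f ] T) {β : T ⇒[ g ] V} {β' : T ⇒[ g' ] V} →
    β ≅ β' → (α ⨾' β) ≅ (α ⨾' β')
  ⨾-congʳ α (refl , refl) = refl , refl

  chosen : ∀ {A B} {f : Hom A B} {T : Ob[ B ]} (P : Pullback f T) →
           IsPullbackOf (Pullback.obj P) f T
  chosen P = Pullback.ℓ P , Pullback.cart P

  transport : ∀ {A B} {S : Ob[ A ]} {T : Ob[ B ]} {f g : Hom A B} →
              f ≡ g → IsPullbackOf S f T → IsPullbackOf S g T
  transport e = subst (λ k → IsPullbackOf _ k _) e

  paste : ∀ {A B C} {f : Hom A B} {g : Hom B C} {S T V} →
          IsPullbackOf S f T → IsPullbackOf T g V → IsPullbackOf S (f ⨾ g) V
  paste {A} {f = f} {g} {S} {T} {V} (ℓ₁ , c₁) (ℓ₂ , c₂) =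
    ℓ₁ ⨾' ℓ₂ , record { R = lift ; R-β = lift-β ; R-η = lift-η }
    where
    module c₁ = Exhibits c₁
    module c₂ = Exhibits c₂

    lift : ∀ {X} {Y : Ob[ X ]} {k : Hom X A} → Y ⇒[ k ⨾ (f ⨾ g) ] V → Y ⇒[ k ] S
    lift {k = k} β = c₁.R (c₂.R (cast (sym (assoc k f g)) β))

    lift-β : ∀ {X} {Y : Ob[ X ]} {k : Hom X A} (β : Y ⇒[ k ⨾ (f ⨾ g) ] V) →
             lift β ⨾' (ℓ₁ ⨾' ℓ₂) ≡ β
    lift-β {k = k} β = ≅→≡ (begin
      lift β ⨾' (ℓ₁ ⨾' ℓ₂)      ≅⟨ ≅-sym (_ , assoc' (lift β) ℓ₁ ℓ₂) ⟩
      (lift β ⨾' ℓ₁) ⨾' ℓ₂      ≅⟨ ⨾-congˡ ℓ₂ (≡→≅ (c₁.R-β _)) ⟩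
      c₂.R (cast _ β) ⨾' ℓ₂     ≅⟨ ≡→≅ (c₂.R-β _) ⟩
      cast (sym (assoc k f g)) β ≅⟨ cast-≅ _ β ⟩
      β                          ∎)
      where open ≅-Reasoning

    lift-η : ∀ {X} {Y : Ob[ X ]} {k : Hom X A} (ζ : Y ⇒[ k ] S) →
             lift (ζ ⨾' (ℓ₁ ⨾' ℓ₂)) ≡ ζ
    lift-η {k = k} ζ = begin
      c₁.R (c₂.R (cast _ (ζ ⨾' (ℓ₁ ⨾' ℓ₂)))) ≡⟨ cong (λ z → c₁.R (c₂.R z)) reassociate ⟩
      c₁.R (c₂.R ((ζ ⨾' ℓ₁) ⨾' ℓ₂))        ≡⟨ cong c₁.R (c₂.R-η (ζ ⨾' ℓ₁)) ⟩
      c₁.R (ζ ⨾' ℓ₁)                        ≡⟨ c₁.R-η ζ ⟩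
      ζ                                     ∎
      where
      open ≡-Reasoning
      reassociate : cast (sym (assoc k f g)) (ζ ⨾' (ℓ₁ ⨾' ℓ₂)) ≡ (ζ ⨾' ℓ₁) ⨾' ℓ₂
      reassociate = ≅→≡ (≅-trans (cast-≅ _ _) (≅-sym (_ , assoc' ζ ℓ₁ ℓ₂)))

  module _ {A B} {f : Hom A B} {S : Ob[ A ]} {T : Ob[ B ]} {ℓ : S ⇒[ f ] T}
           (c : Exhibits ℓ) where
    open Exhibits c

    cancel : ∀ {X} {Y : Ob[ X ]} {g g' : Hom X A} (ζ₁ : Y ⇒[ g ] S) (ζ₂ : Y ⇒[ g' ] S) →
             g ≡ g' → (ζ₁ ⨾' ℓ) ≅ (ζ₂ ⨾' ℓ) → ζ₁ ≅ ζ₂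
    cancel ζ₁ ζ₂ refl q = refl , (begin
      ζ₁           ≡⟨ sym (R-η ζ₁) ⟩
      R (ζ₁ ⨾' ℓ)  ≡⟨ cong R (≅→≡ q) ⟩
      R (ζ₂ ⨾' ℓ)  ≡⟨ R-η ζ₂ ⟩
      ζ₂           ∎)
      where open ≡-Reasoning

    comparison : ∀ {S'} → S' ⇒[ f ] T → S' ≤ S
    comparison ℓ' = R (cast (sym (idˡ f)) ℓ')

    comparison-β : ∀ {S'} (ℓ' : S' ⇒[ f ] T) → (comparison ℓ' ⨾' ℓ) ≅ ℓ'
    comparison-β ℓ' = ≅-trans (≡→≅ (R-β _)) (cast-≅ _ ℓ')

  comparison-inverse : ∀ {A B} {f : Hom A B} {S S' : Ob[ A ]} {T : Ob[ B ]}
    {ℓ : S ⇒[ f ] T} {ℓ' : S' ⇒[ f ] T} (c : Exhibits ℓ) (c' : Exhibits ℓ') →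
    PathOver (λ k → S ⇒[ k ] S) (idˡ id) (comparison c' ℓ ⨾' comparison c ℓ') id'
  comparison-inverse {S = S} {S'} {ℓ = ℓ} {ℓ'} c c' =
    ≅→PathOver (idˡ id) (cancel c (φ ⨾' ψ) id' (idˡ id) (begin
      (φ ⨾' ψ) ⨾' ℓ  ≅⟨ _ , assoc' φ ψ ℓ ⟩
      φ ⨾' (ψ ⨾' ℓ)  ≅⟨ ⨾-congʳ φ (comparison-β c ℓ') ⟩
      φ ⨾' ℓ'        ≅⟨ comparison-β c' ℓ ⟩
      ℓ              ≅⟨ ≅-sym (_ , idˡ' ℓ) ⟩
      id' ⨾' ℓ       ∎))
    where
    open ≅-Reasoning
    φ : S ≤ S'
    φ = comparison c' ℓ
    ψ : S' ≤ S
    ψ = comparison c ℓ'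

  pullbacks-unique : ∀ {A B} {f : Hom A B} {S S' : Ob[ A ]} {T : Ob[ B ]} →
    IsPullbackOf S f T → IsPullbackOf S' f T → VerticalIso S S'
  pullbacks-unique (ℓ , c) (ℓ' , c') =
    comparison c' ℓ , comparison c ℓ' , comparison-inverse c c' , comparison-inverse c' c

module ShiftFactorisation {o h} {I : Category o h} {M : Monoidal I} (CI : Closed M) where
  open Category I
  open Monoidal M
  open Closed CI
  open ≡-Reasoning

  λ⇐-nat : ∀ {A A'} (f : Hom A A') → f ⨾ λ⇐ ≡ λ⇐ ⨾ (id ⊗₁ f)
  λ⇐-nat f = begin
    f ⨾ λ⇐                         ≡⟨ sym (idˡ _) ⟩
    id ⨾ (f ⨾ λ⇐)                  ≡⟨ cong (_⨾ (f ⨾ λ⇐)) (sym λ-iso₂) ⟩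
    (λ⇐ ⨾ λ⇒) ⨾ (f ⨾ λ⇐)           ≡⟨ assoc _ _ _ ⟩
    λ⇐ ⨾ (λ⇒ ⨾ (f ⨾ λ⇐))           ≡⟨ cong (λ⇐ ⨾_) (sym (assoc _ _ _)) ⟩
    λ⇐ ⨾ ((λ⇒ ⨾ f) ⨾ λ⇐)           ≡⟨ cong (λ z → λ⇐ ⨾ (z ⨾ λ⇐)) (sym (λ-nat f)) ⟩
    λ⇐ ⨾ (((id ⊗₁ f) ⨾ λ⇒) ⨾ λ⇐)   ≡⟨ cong (λ⇐ ⨾_) (assoc _ _ _) ⟩
    λ⇐ ⨾ ((id ⊗₁ f) ⨾ (λ⇒ ⨾ λ⇐))   ≡⟨ cong (λ z → λ⇐ ⨾ ((id ⊗₁ f) ⨾ z)) λ-iso₁ ⟩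
    λ⇐ ⨾ ((id ⊗₁ f) ⨾ id)          ≡⟨ cong (λ⇐ ⨾_) (idʳ _) ⟩
    λ⇐ ⨾ (id ⊗₁ f)                 ∎

  ⊗-interchange : ∀ {A A' B B'} (f : Hom A A') (g : Hom B B') →
                  (id ⊗₁ g) ⨾ (f ⊗₁ id) ≡ (f ⊗₁ id) ⨾ (id ⊗₁ g)
  ⊗-interchange f g = begin
    (id ⊗₁ g) ⨾ (f ⊗₁ id)  ≡⟨ sym (⊗-⨾ id f g id) ⟩
    (id ⨾ f) ⊗₁ (g ⨾ id)   ≡⟨ cong₂ _⊗₁_ (trans (idˡ f) (sym (idʳ f)))
                                         (trans (idʳ g) (sym (idˡ g))) ⟩
    (f ⨾ id) ⊗₁ (id ⨾ g)   ≡⟨ ⊗-⨾ f id id g ⟩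
    (f ⊗₁ id) ⨾ (id ⊗₁ g)  ∎

  -- every g : B → X factors through shift_{B,X} : B → (X ∕ B) ∖ X, followed
  -- by evaluation of the residual at the name ρ(λ⇒ ; g) : 𝟏 → X ∕ B of g
  shift-factorisation : ∀ {B X} (g : Hom B X) →
    shift B X ⨾ (λ⇐ ⨾ (curryʳ (λ⇒ ⨾ g) ⊗₁ id) ⨾ evˡ) ≡ g
  shift-factorisation {B} {X} g = begin
    s ⨾ (λ⇐ ⨾ (k ⊗₁ id) ⨾ evˡ)                ≡⟨ sym (assoc _ _ _) ⟩
    (s ⨾ λ⇐) ⨾ ((k ⊗₁ id) ⨾ evˡ)              ≡⟨ cong (_⨾ ((k ⊗₁ id) ⨾ evˡ)) (λ⇐-nat s) ⟩
    (λ⇐ ⨾ (id ⊗₁ s)) ⨾ ((k ⊗₁ id) ⨾ evˡ)      ≡⟨ assoc _ _ _ ⟩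
    λ⇐ ⨾ ((id ⊗₁ s) ⨾ ((k ⊗₁ id) ⨾ evˡ))      ≡⟨ cong (λ⇐ ⨾_) (sym (assoc _ _ _)) ⟩
    λ⇐ ⨾ (((id ⊗₁ s) ⨾ (k ⊗₁ id)) ⨾ evˡ)      ≡⟨ cong (λ z → λ⇐ ⨾ (z ⨾ evˡ)) (⊗-interchange k s) ⟩
    λ⇐ ⨾ (((k ⊗₁ id) ⨾ (id ⊗₁ s)) ⨾ evˡ)      ≡⟨ cong (λ⇐ ⨾_) (assoc _ _ _) ⟩
    λ⇐ ⨾ ((k ⊗₁ id) ⨾ ((id ⊗₁ s) ⨾ evˡ))      ≡⟨ cong (λ z → λ⇐ ⨾ ((k ⊗₁ id) ⨾ z)) (curryˡ-β evʳ) ⟩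
    λ⇐ ⨾ ((k ⊗₁ id) ⨾ evʳ)                    ≡⟨ cong (λ⇐ ⨾_) (curryʳ-β (λ⇒ ⨾ g)) ⟩
    λ⇐ ⨾ (λ⇒ ⨾ g)                             ≡⟨ sym (assoc _ _ _) ⟩
    (λ⇐ ⨾ λ⇒) ⨾ g                             ≡⟨ cong (_⨾ g) λ-iso₂ ⟩
    id ⨾ g                                    ≡⟨ idˡ g ⟩
    g                                         ∎
    where
    s : Hom B ((X ∕ B) ∖ X)
    s = shift B X
    k : Hom 𝟏 (X ∕ B)
    k = curryʳ (λ⇒ ⨾ g)

mainTheorem1 :
    ∀ {oi hi oj hj oe he od hd : Level}
      {I : Category oi hi} {M : Monoidal I} (CI : Closed M)
      {E : TRS I oe he} (ME : MonoidalTRS M E) (CE : ClosedTRS CI ME)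
      (fib : TRS.Fibration E) (⊗-pres : TensorPreservesPullbacks ME fib)
      {J : Category oj hj} {D : TRS J od hd}
      {L₀ : Functor I J} {R₀ : Functor J I} (adj₀ : Adjunction L₀ R₀)
      (L₁ : TRSFunctor E D L₀) (R₁ : TRSFunctor D E R₀)
      (adj₁ : TRSAdjunction adj₀ L₁ R₁)
      (st₀ : Strength M adj₀) (st₁ : StrengthTRS ME adj₁ st₀)
      {C : Category.Obj J} (U : TRS.Ob[_] D C) (enc : Universal D U)
      (refl : Reflected CI ME CE adj₀ L₁ R₁ U enc) →
      ∀ {B : Category.Obj I} (T : TRS.Ob[_] E B) →
        TRS.VerticalIso E
          (TRS.Pullback.obj (fib (Adjunction.η adj₀ B)
             (TRSFunctor.G₀ R₁ (TRSFunctor.G₀ L₁ T))))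
          (TRS.Pullback.obj (fib (Closed.shift CI B (Functor.F₀ R₀ C))
             (ClosedTRS._∖'_ CE
               (ClosedTRS._∕'_ CE (TRSFunctor.G₀ R₁ U) T)
               (TRSFunctor.G₀ R₁ U))))
mainTheorem1 {I = I} CI {E = E} ME CE fib _ {J} {D} {L₀} {R₀} adj₀ L₁ R₁ _ _ _ {C} U enc reflected {B} T =
  pullbacks-unique viaUnit (transport (shift-factorisation CI (η B ⨾ F₁ e)) viaShift)
  where
  open Category I
  open TRS E
  open Cartesian E
  open ShiftFactorisation using (shift-factorisation)
  open Adjunction adj₀ using (η)
  open Functor R₀ using (F₀; F₁)
  open Closed CI using (shift)
  open ClosedTRS CE using (_∖'_; _∕'_)
  open Reflected reflected using (reflExpr; preservesPullbacks; reflectsShift)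
  module L₁ = TRSFunctor L₁
  module R₁ = TRSFunctor R₁

  e : Category.Hom J (Functor.F₀ L₀ B) C
  e = proj₁ (enc (L₁.G₀ T))
  encoding : TRS.IsPullbackOf D (L₁.G₀ T) e U
  encoding = proj₂ (enc (L₁.G₀ T))

  viaUnit : IsPullbackOf (Pullback.obj (fib (η B) (R₁.G₀ (L₁.G₀ T)))) (η B ⨾ F₁ e) (R₁.G₀ U)
  viaUnit = paste (chosen (fib (η B) _)) (R₁.G₁ (proj₁ encoding) , preservesPullbacks _ (proj₂ encoding))

  viaShift : IsPullbackOf (Pullback.obj (fib (shift B (F₀ C)) ((R₁.G₀ U ∕' T) ∖' R₁.G₀ U)))
                          (shift B (F₀ C) ⨾ reflExpr T) (R₁.G₀ U)
  viaShift = paste (chosen (fib (shift B (F₀ C)) _)) (reflectsShift T)
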